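{- Let $A$ be a positive integer with $A\equiv 27,45,51$ or $69\pmod{72}$. Then there is no binary sequence $\mathbf a$ of period $n=\tfrac14(A^2+3)$ with $C_{\mathbf a}(t)=3$ for all $1\le t\le n-1$.
   Context: A binary sequence of period $n$ is $\mathbf a=(a_0,a_1,\ldots)$ with $a_j\in\{ -1,1\}$ and $a_{j+n}=a_j$ for all $j\ge0$; its autocorrelation values are $C_{\mathbf a}(t)=\sum_{i=0}^{n-1}a_ia_{i+t}$. -}

module Defs where

open import Data.Nat using (ℕ; zero; suc)
open import Data.Integer using (ℤ; +_; -_; _+_; _*_)
open import Data.Sum using (_⊎_)
open import Data.Product using (_×_)
open import Relation.Binary.PropositionalEquality using (_≡_)

IsBinarySeq : (n : ℕ) → (ℕ → ℤ) → Set
IsBinarySeq n a =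
  ((j : ℕ) → (a j ≡ + 1) ⊎ (a j ≡ - (+ 1))) × ((j : ℕ) → a (j Data.Nat.+ n) ≡ a j)

sumTo : ℕ → (ℕ → ℤ) → ℤ
sumTo zero    f = + 0
sumTo (suc m) f = sumTo m f + f m

autocorr : (n : ℕ) → (ℕ → ℤ) → ℕ → ℤ
autocorr n a t = sumTo n (λ i → a i * a (i Data.Nat.+ t))

-- Write A = 6t + 3, so that n = 3q with q = 3t² + 3t + 1. Let c₀, c₁, c₂ be the sums of the
-- sequence over the positions ≡ 0, 1, 2 (mod 3) in one period. Summing the autocorrelation over the
-- shifts ≡ 0 and ≡ 1 (mod 3) gives c₀² + c₁² + c₂² = n + 3(q − 1) and c₀c₁ + c₁c₂ + c₂c₀ = 3q, so
-- x = c₀ − c₁, y = c₁ − c₂ solve x² + xy + y² = n − 3 = 9t(t + 1). The congruence on A makes one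
-- of t, t + 1 congruent to 2 (mod 3); such a number has a prime factor p ≡ 2 (mod 3) to an odd
-- power, and p does not divide 9 times the other factor. But by Fermat's little theorem a prime
-- p ≡ 2 (mod 3) divides x² + xy + y² only if it divides x and y, so it occurs in every value of
-- this form to an even power.
module Submission where

open import Data.Nat as ℕ using (ℕ; zero; suc; _!; _%_; _/_; _<_; _≤_; _∸_; z<s; s<s; s≤s; z≤n)
import Data.Nat.Divisibility as ℕ
import Data.Nat.Properties as ℕ
import Data.Nat.Tactic.RingSolver as ℕ
open import Data.Nat.DivMod
  using (m/n*n≡m; m≡m%n+[m/n]*n; %-distribˡ-*; m%n<n; [m+kn]%n≡m%n; m∣n⇒o%n%m≡o%m)
open import Data.Nat.Primality
  using (Prime; euclidsLemma; ¬prime[0]; ¬prime[1]; prime⇒nonZero; prime⇒nonTrivial; prime⇒irreducible)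
open import Data.Product using (_×_; _,_; ∃; ∃₂; proj₁)
open import Data.Sum using (_⊎_; inj₁; inj₂; [_,_])
open import Function using (_∘_)
open import Relation.Binary.PropositionalEquality hiding ([_])
open import Relation.Nullary using (¬_; contradiction)

module FermatsLittleTheorem where

  open import Data.Fin as Fin using (Fin; toℕ)
  import Data.Fin.Properties as Fin
  open import Data.Integer as ℤ using (ℤ; +_; -[1+_]; _+_; _*_; _-_; _^_; 0ℤ; 1ℤ)
  import Data.Integer.Properties as ℤ
  open import Data.Integer.Divisibility.Signed
  open import Data.Integer.Tactic.RingSolver using (solve-∀)
  open import Data.Nat.Combinatorics using (_C_; nCk≡n!/k![n-k]!; k![n∸k]!∣n!; nCn≡1)
  open import Data.Vec.Functional using (Vector; init; last; tail)
  open import Algebra.Properties.Semiring.Mult ℤ.+-*-semiring using () renaming (_×_ to _·_)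
  open import Algebra.Properties.Semiring.Sum ℤ.+-*-semiring using (sum; sum-init-last)
  import Algebra.Properties.Semiring.Exp ℤ.+-*-semiring as Exp
  open import Algebra.Properties.CommutativeSemiring.Binomial ℤ.+-*-commutativeSemiring
    using (binomialTerm; theorem)

  prime∤! : ∀ {p k} → Prime p → k < p → ¬ p ℕ.∣ k !
  prime∤! {k = zero}  pr _   p∣1   = ¬prime[1] (subst Prime (ℕ.∣1⇒≡1 p∣1) pr)
  prime∤! {k = suc k} pr k<p p∣k! with euclidsLemma (suc k) (k !) pr p∣k!
  ... | inj₁ p∣1+k = ℕ.<⇒≱ k<p (ℕ.∣⇒≤ p∣1+k)
  ... | inj₂ p∣k!  = prime∤! pr (ℕ.<-trans (ℕ.n<1+n k) k<p) p∣k!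

  p∣pCk : ∀ {p k} → Prime p → 0 < k → k < p → p ℕ.∣ p C k
  p∣pCk {p@(suc p-1)} {k} pr 0<k k<p
    with euclidsLemma (p C k) (k ! ℕ.* (p ∸ k) !) pr p∣pCk*k!*[p∸k]!
    where
    instance
      k![p∸k]!≢0 = ℕ._!*_!≢0 k (p ∸ k)
    p∣pCk*k!*[p∸k]! : p ℕ.∣ (p C k) ℕ.* (k ! ℕ.* (p ∸ k) !)
    p∣pCk*k!*[p∸k]! = subst (p ℕ.∣_)
      (sym (trans (cong (ℕ._* (k ! ℕ.* (p ∸ k) !)) (nCk≡n!/k![n-k]! (ℕ.<⇒≤ k<p)))
                  (m/n*n≡m (k![n∸k]!∣n! (ℕ.<⇒≤ k<p)))))
      (ℕ.m∣m*n (p-1 !))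
  ... | inj₁ p∣pCk = p∣pCk
  ... | inj₂ p∣k!*[p∸k]! with euclidsLemma (k !) ((p ∸ k) !) pr p∣k!*[p∸k]!
  ...   | inj₁ p∣k!     = contradiction p∣k! (prime∤! pr k<p)
  ...   | inj₂ p∣[p∸k]! = contradiction p∣[p∸k]! (prime∤! pr (ℕ.∸-monoʳ-< 0<k (ℕ.<⇒≤ k<p)))

  ^-as-ℤ^ : ∀ x n → x Exp.^ n ≡ x ^ n
  ^-as-ℤ^ x zero    = refl
  ^-as-ℤ^ x (suc n) = cong (x *_) (^-as-ℤ^ x n)

  n·x≡+n*x : ∀ n x → n · x ≡ + n * x
  n·x≡+n*x zero    x = sym (ℤ.*-zeroˡ x)
  n·x≡+n*x (suc n) x = trans (cong (λ y → x + y) (n·x≡+n*x n x)) (sym (ℤ.suc-* (+ n) x))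

  ∣-sum : ∀ {d n} (t : Vector ℤ n) → (∀ i → d ∣ t i) → d ∣ sum t
  ∣-sum {n = zero}  t d∣t = divides 0ℤ refl
  ∣-sum {n = suc n} t d∣t = ∣m∣n⇒∣m+n (d∣t Fin.zero) (∣-sum (tail t) (d∣t ∘ Fin.suc))

  prime∣[1+x]^p-x^p-1 : ∀ {p} → Prime p → ∀ x → + p ∣ (1ℤ + x) ^ p - x ^ p - 1ℤ
  prime∣[1+x]^p-x^p-1 {zero}      pr = contradiction pr ¬prime[0]
  prime∣[1+x]^p-x^p-1 {p@(suc m)} pr x =
    subst (+ p ∣_) (sym [1+x]^p-x^p-1≡sum-middle) (∣-sum middle p∣middle)
    where
    term : Fin (suc p) → ℤ
    term = binomialTerm 1ℤ x p

    middle : Vector ℤ m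
    middle = init (tail term)

    term-at : ∀ i k → toℕ i ≡ k → term i ≡ + (p C k) * (1ℤ ^ k * x ^ (p ∸ k))
    term-at i _ refl = trans (n·x≡+n*x (p C toℕ i) _)
      (cong₂ (λ u v → + (p C toℕ i) * (u * v)) (^-as-ℤ^ 1ℤ (toℕ i)) (^-as-ℤ^ x (p ∸ toℕ i)))

    first-term : term Fin.zero ≡ x ^ p
    first-term = begin
      term Fin.zero         ≡⟨ term-at Fin.zero 0 refl ⟩
      1ℤ * (1ℤ * x ^ p)     ≡⟨ trans (ℤ.*-identityˡ _) (ℤ.*-identityˡ _) ⟩
      x ^ p                 ∎
      where open ≡-Reasoning

    last-term : last (tail term) ≡ 1ℤ
    last-term = begin
      last (tail term)                    ≡⟨ term-at _ p (cong suc (Fin.toℕ-fromℕ m)) ⟩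
      + (p C p) * (1ℤ ^ p * x ^ (p ∸ p))
        ≡⟨ cong₂ (λ c e → + c * (1ℤ ^ p * x ^ e)) (nCn≡1 p) (ℕ.n∸n≡0 p) ⟩
      1ℤ * (1ℤ ^ p * 1ℤ)                  ≡⟨ trans (ℤ.*-identityˡ _) (ℤ.*-identityʳ _) ⟩
      1ℤ ^ p                              ≡⟨ ℤ.^-zeroˡ p ⟩
      1ℤ                                  ∎
      where open ≡-Reasoning

    p∣middle : ∀ j → + p ∣ middle j
    p∣middle j = subst (+ p ∣_) (sym (term-at _ k (cong suc (Fin.toℕ-inject₁ j))))
      (∣m⇒∣m*n (1ℤ ^ k * x ^ (p ∸ k)) (∣ᵤ⇒∣ {+ p} {+ (p C k)} (p∣pCk pr z<s (s<s (Fin.toℕ<n j)))))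
      where k = suc (toℕ j)

    [1+x]^p-x^p-1≡sum-middle : (1ℤ + x) ^ p - x ^ p - 1ℤ ≡ sum middle
    [1+x]^p-x^p-1≡sum-middle = begin
      (1ℤ + x) ^ p - x ^ p - 1ℤ
        ≡⟨ cong (λ y → y - x ^ p - 1ℤ) (trans (sym (^-as-ℤ^ (1ℤ + x) p)) (theorem p 1ℤ x)) ⟩
      term Fin.zero + sum (tail term) - x ^ p - 1ℤ
        ≡⟨ cong (λ y → term Fin.zero + y - x ^ p - 1ℤ) (sum-init-last (tail term)) ⟩
      term Fin.zero + (sum middle + last (tail term)) - x ^ p - 1ℤ
        ≡⟨ cong₂ (λ a b → a + (sum middle + b) - x ^ p - 1ℤ) first-term last-term ⟩
      x ^ p + (sum middle + 1ℤ) - x ^ p - 1ℤ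
        ≡⟨ cancel (sum middle) (x ^ p) ⟩
      sum middle
        ∎
      where
      open ≡-Reasoning
      cancel : ∀ s y → y + (s + 1ℤ) - y - 1ℤ ≡ s
      cancel = solve-∀

  ∣-of-increments : ∀ {d} (g : ℤ → ℤ) → d ∣ g 0ℤ → (∀ x → d ∣ g (1ℤ + x) - g x) → ∀ x → d ∣ g x
  ∣-of-increments {d} g d∣g0 d∣Δg = go
    where
    ∣-up : ∀ {a b} → d ∣ a - b → d ∣ b → d ∣ a
    ∣-up d∣a-b d∣b = ∣m+n∣n⇒∣m d∣a-b (∣m⇒∣-m d∣b)

    ∣-down : ∀ {a b} → d ∣ a - b → d ∣ a → d ∣ b
    ∣-down {b = b} d∣a-b d∣a = subst (d ∣_) (ℤ.neg-involutive b) (∣m⇒∣-m (∣m+n∣m⇒∣n d∣a-b d∣a))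

    go : ∀ x → d ∣ g x
    go (+ zero)     = d∣g0
    go (+ suc n)    = ∣-up (d∣Δg (+ n)) (go (+ n))
    go -[1+ zero ]  = ∣-down (d∣Δg -[1+ zero ]) d∣g0
    go -[1+ suc n ] = ∣-down (d∣Δg -[1+ suc n ]) (go -[1+ n ])

  fermat : ∀ {p} → Prime p → ∀ x → + p ∣ x ^ p - x
  fermat {zero}      pr = contradiction pr ¬prime[0]
  fermat {p@(suc _)} pr = ∣-of-increments (λ x → x ^ p - x) (divides 0ℤ refl) λ x →
    subst (+ p ∣_) (sym (regroup ((1ℤ + x) ^ p) (x ^ p) x)) (prime∣[1+x]^p-x^p-1 pr x)
    where
    regroup : ∀ u v x → u - (1ℤ + x) - (v - x) ≡ u - v - 1ℤ
    regroup = solve-∀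

open FermatsLittleTheorem using (fermat)

module LöschianNumbers where

  open import Data.Integer as ℤ using (ℤ; +_; -_; _+_; _*_; _-_; _^_; 0ℤ; 1ℤ)
  import Data.Integer.Properties as ℤ
  open import Data.Integer.Divisibility.Signed
  open import Data.Integer.Tactic.RingSolver using (solve-∀)
  open import Data.List using ([]; _∷_)
  open import Data.List.Relation.Unary.All using (_∷_)
  open import Data.Nat.Induction using (<-rec)
  open import Data.Nat.ListAction using (product)
  open import Data.Nat.Primality.Factorisation using (factorise)

  m*n%3≡2⇒ : ∀ m n → (m ℕ.* n) % 3 ≡ 2 → (m % 3 ≡ 1 × n % 3 ≡ 2) ⊎ (m % 3 ≡ 2 × n % 3 ≡ 1)
  m*n%3≡2⇒ m n mn%3≡2
    with m % 3 | n % 3 | m%n<n m 3 | m%n<n n 3 | trans (sym (%-distribˡ-* m n 3)) mn%3≡2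
  ... | 1 | 2 | _ | _ | _ = inj₁ (refl , refl)
  ... | 2 | 1 | _ | _ | _ = inj₂ (refl , refl)
  ... | 0 | _ | _ | _ | ()
  ... | 1 | 0 | _ | _ | ()
  ... | 1 | 1 | _ | _ | ()
  ... | 2 | 0 | _ | _ | ()
  ... | 2 | 2 | _ | _ | ()
  ... | suc (suc (suc _)) | _ | s≤s (s≤s (s≤s ())) | _ | _
  ... | _ | suc (suc (suc _)) | _ | s≤s (s≤s (s≤s ())) | _

  n%3≡2⇒n*n%3≡1 : ∀ {n} → n % 3 ≡ 2 → (n ℕ.* n) % 3 ≡ 1
  n%3≡2⇒n*n%3≡1 {n} n%3≡2 = trans (%-distribˡ-* n n 3) (cong (λ r → (r ℕ.* r) % 3) n%3≡2)

  n%3≡2⇒2≤n : ∀ {n} → n % 3 ≡ 2 → 2 ≤ n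
  n%3≡2⇒2≤n {suc (suc _)} _ = s≤s (s≤s z≤n)

  n%3≡2⇒n∤3 : ∀ {n} → n % 3 ≡ 2 → ¬ n ℕ.∣ 3
  n%3≡2⇒n∤3 {n} n%3≡2 n∣3 = excluded n n%3≡2 n∣3 (ℕ.∣⇒≤ n∣3)
    where
    excluded : ∀ n → n % 3 ≡ 2 → n ℕ.∣ 3 → ¬ n ≤ 3
    excluded 2 _ (ℕ.divides (suc (suc _)) ())
    excluded (suc (suc (suc (suc _)))) _ _ (s≤s (s≤s (s≤s ())))

  ∃-prime-divisor : ∀ {s} → 2 ≤ s → ∃ λ p → Prime p × p ℕ.∣ s
  ∃-prime-divisor {s@(suc _)} 2≤s with factorise s
  ... | record { factors = [] ; isFactorisation = s≡1 } =
    contradiction (subst (2 ≤_) s≡1 2≤s) λ { (s≤s ()) }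
  ... | record { factors = p ∷ ps ; isFactorisation = s≡p*∏ps ; factorsPrime = pr ∷ _ } =
    p , pr , subst (p ℕ.∣_) (sym s≡p*∏ps) (ℕ.m∣m*n (product ps))

  prime∣prime⇒≡ : ∀ {q p} → Prime q → Prime p → q ℕ.∣ p → q ≡ p
  prime∣prime⇒≡ qr pr q∣p with prime⇒irreducible pr q∣p
  ... | inj₁ q≡1 = contradiction (subst Prime q≡1 qr) ¬prime[1]
  ... | inj₂ q≡p = q≡p

  prime∣*⇒∣⊎∣ : ∀ {p} → Prime p → ∀ u v → + p ∣ u * v → + p ∣ u ⊎ + p ∣ v
  prime∣*⇒∣⊎∣ pr u v p∣uv with euclidsLemma ℤ.∣ u ∣ ℤ.∣ v ∣ pr (subst (_ ℕ.∣_) (ℤ.abs-* u v) (∣⇒∣ᵤ p∣uv))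
  ... | inj₁ p∣u = inj₁ (∣ᵤ⇒∣ p∣u)
  ... | inj₂ p∣v = inj₂ (∣ᵤ⇒∣ p∣v)

  prime∣²⇒∣ : ∀ {p} → Prime p → ∀ u → + p ∣ u * u → + p ∣ u
  prime∣²⇒∣ pr u p∣uu with prime∣*⇒∣⊎∣ pr u u p∣uu
  ... | inj₁ p∣u = p∣u
  ... | inj₂ p∣u = p∣u

  ∣m-n⇒∣m^k-n^k : ∀ {d m n} → d ∣ m - n → ∀ k → d ∣ m ^ k - n ^ k
  ∣m-n⇒∣m^k-n^k _ zero = divides 0ℤ refl
  ∣m-n⇒∣m^k-n^k {d} {m} {n} d∣m-n (suc k) =
    subst (d ∣_) (sym (split m n (m ^ k) (n ^ k)))
      (∣m∣n⇒∣m+n (∣n⇒∣m*n m (∣m-n⇒∣m^k-n^k d∣m-n k)) (∣n⇒∣m*n (n ^ k) d∣m-n))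
    where
    split : ∀ m n M N → m * M - n * N ≡ m * (M - N) + N * (m - n)
    split = solve-∀

  ^[2+3k] : ∀ x k → x ^ (2 ℕ.+ 3 ℕ.* k) ≡ x * x * (x * x * x) ^ k
  ^[2+3k] x k = begin
    x ^ (2 ℕ.+ 3 ℕ.* k)        ≡⟨ ℤ.^-distribˡ-+-* x 2 (3 ℕ.* k) ⟩
    x ^ 2 * x ^ (3 ℕ.* k)      ≡⟨ cong (x ^ 2 *_) (sym (ℤ.^-*-assoc x 3 k)) ⟩
    x ^ 2 * (x ^ 3) ^ k        ≡⟨ cong₂ (λ u v → u * v ^ k) (square x) (cube x) ⟩
    x * x * (x * x * x) ^ k    ∎
    where
    open ≡-Reasoning
    square : ∀ x → x * (x * 1ℤ) ≡ x * x
    square = solve-∀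
    cube : ∀ x → x * (x * (x * 1ℤ)) ≡ x * x * x
    cube = solve-∀

  -- The norm of x − y ω in ℤ[ω], where ω is a primitive cube root of unity.
  norm : ℤ → ℤ → ℤ
  norm x y = x * x + x * y + y * y

  -- With p = 3k + 2, X = (x³)ᵏ and Y = (y³)ᵏ, Fermat gives x ≡ x²X and y ≡ y²Y (mod p), while
  -- X ≡ Y because x³ ≡ y³; hence xy² ≡ x²y.
  prime∣norm⇒∣xy[y-x] : ∀ {p} → Prime p → p % 3 ≡ 2 → ∀ x y → + p ∣ norm x y → + p ∣ x * y * (y - x)
  prime∣norm⇒∣xy[y-x] {p} pr p%3≡2 x y p∣N = subst (+ p ∣_) (sym (combine x y X Y))
    (∣m∣n⇒∣m+n (∣m∣n⇒∣m+n (∣m⇒∣-m (∣m⇒∣m*n (y * y) (fermat′ x)))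
                            (∣n⇒∣m*n (x * x * y * y) (∣m-n⇒∣m^k-n^k p∣x³-y³ k)))
               (∣n⇒∣m*n (x * x) (fermat′ y)))
    where
    k = p / 3
    X = (x * x * x) ^ k
    Y = (y * y * y) ^ k

    p≡2+3k : p ≡ 2 ℕ.+ 3 ℕ.* k
    p≡2+3k = trans (m≡m%n+[m/n]*n p 3) (cong₂ ℕ._+_ p%3≡2 (ℕ.*-comm k 3))

    fermat′ : ∀ z → + p ∣ z * z * (z * z * z) ^ k - z
    fermat′ z = subst (λ w → + p ∣ w - z) (trans (cong (z ^_) p≡2+3k) (^[2+3k] z k)) (fermat pr z)

    p∣x³-y³ : + p ∣ x * x * x - y * y * y
    p∣x³-y³ = subst (+ p ∣_) (sym (difference-of-cubes x y)) (∣n⇒∣m*n (x - y) p∣N)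
      where
      difference-of-cubes : ∀ x y → x * x * x - y * y * y ≡ (x - y) * (x * x + x * y + y * y)
      difference-of-cubes = solve-∀

    combine : ∀ x y X Y → x * y * (y - x)
            ≡ - ((x * x * X - x) * (y * y)) + x * x * y * y * (X - Y) + x * x * (y * y * Y - y)
    combine = solve-∀

  prime∣norm⇒∣ : ∀ {p} → Prime p → p % 3 ≡ 2 → ∀ x y → + p ∣ norm x y → + p ∣ x × + p ∣ y
  prime∣norm⇒∣ {p} pr p%3≡2 x y p∣N =
    cases (prime∣*⇒∣⊎∣ pr (x * y) (y - x) (prime∣norm⇒∣xy[y-x] pr p%3≡2 x y p∣N))
    where
    from-x : + p ∣ x → + p ∣ x × + p ∣ y
    from-x p∣x = p∣x , prime∣²⇒∣ pr y
      (subst (+ p ∣_) (sym (y² x y)) (∣m∣n⇒∣m-n p∣N (∣m⇒∣m*n (x + y) p∣x)))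
      where
      y² : ∀ x y → y * y ≡ x * x + x * y + y * y - x * (x + y)
      y² = solve-∀

    from-y : + p ∣ y → + p ∣ x × + p ∣ y
    from-y p∣y = prime∣²⇒∣ pr x
      (subst (+ p ∣_) (sym (x² x y)) (∣m∣n⇒∣m-n p∣N (∣m⇒∣m*n (x + y) p∣y))) , p∣y
      where
      x² : ∀ x y → x * x ≡ x * x + x * y + y * y - y * (x + y)
      x² = solve-∀

    p∣3x² : + p ∣ y - x → + p ∣ + 3 * (x * x)
    p∣3x² p∣y-x = subst (+ p ∣_) (sym (3x² x y)) (∣m∣n⇒∣m-n p∣N (∣m⇒∣m*n (y + + 2 * x) p∣y-x))
      where
      3x² : ∀ x y → + 3 * (x * x) ≡ x * x + x * y + y * y - (y - x) * (y + + 2 * x)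
      3x² = solve-∀

    cases : + p ∣ x * y ⊎ + p ∣ y - x → + p ∣ x × + p ∣ y
    cases (inj₁ p∣xy)  = [ from-x , from-y ] (prime∣*⇒∣⊎∣ pr x y p∣xy)
    cases (inj₂ p∣y-x) =
      [ (λ p∣3 → contradiction (∣⇒∣ᵤ p∣3) (n%3≡2⇒n∤3 p%3≡2)) , from-x ∘ prime∣²⇒∣ pr x ]
        (prime∣*⇒∣⊎∣ pr (+ 3) (x * x) (p∣3x² p∣y-x))

  Löschian : ℤ → Set
  Löschian N = ∃₂ λ x y → norm x y ≡ N

  löschian-descent : ∀ {p m} → Prime p → p % 3 ≡ 2 → Löschian (+ (p ℕ.* m)) →
                     ∃ λ k → m ≡ p ℕ.* k × Löschian (+ k)
  löschian-descent {p} {m} pr p%3≡2 (x , y , N≡pm) =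
    descend (prime∣norm⇒∣ pr p%3≡2 x y (subst (+ p ∣_) (sym N≡+p*+m) (∣m⇒∣m*n (+ m) ∣-refl)))
    where
    instance _ = prime⇒nonZero pr
    N≡+p*+m : norm x y ≡ + p * + m
    N≡+p*+m = trans N≡pm (ℤ.pos-* p m)

    descend : + p ∣ x × + p ∣ y → ∃ λ k → m ≡ p ℕ.* k × Löschian (+ k)
    descend (divides a x≡ap , divides b y≡bp) = k , m≡pk , a , b , Nab≡k
      where
      p²-factor : ∀ a b p → a * p * (a * p) + a * p * (b * p) + b * p * (b * p)
                          ≡ p * (p * (a * a + a * b + b * b))
      p²-factor = solve-∀
      m≡pNab : + m ≡ + p * norm a b
      m≡pNab = ℤ.*-cancelˡ-≡ (+ p) (+ m) _
        (trans (sym N≡+p*+m) (trans (cong₂ norm x≡ap y≡bp) (p²-factor a b (+ p))))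
      p∣m : p ℕ.∣ m
      p∣m = ∣⇒∣ᵤ {+ p} {+ m} (divides (norm a b) (trans m≡pNab (ℤ.*-comm (+ p) _)))
      k = ℕ.quotient p∣m
      m≡pk : m ≡ p ℕ.* k
      m≡pk = ℕ.m∣n⇒n≡m*quotient p∣m
      Nab≡k : norm a b ≡ + k
      Nab≡k = ℤ.*-cancelˡ-≡ (+ p) _ _ (trans (sym m≡pNab) (trans (cong +_ m≡pk) (ℤ.pos-* p k)))

  löschian-strip : ∀ {p t m} → Prime p → p % 3 ≡ 2 → ¬ p ℕ.∣ m → Löschian (+ (p ℕ.* (t ℕ.* m))) →
                   ∃ λ t′ → t ≡ p ℕ.* t′ × Löschian (+ (t′ ℕ.* m))
  löschian-strip {p} {t} {m} pr p%3≡2 p∤m L = strip (löschian-descent pr p%3≡2 L)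
    where
    instance _ = prime⇒nonZero pr
    strip : (∃ λ k → t ℕ.* m ≡ p ℕ.* k × Löschian (+ k)) →
            ∃ λ t′ → t ≡ p ℕ.* t′ × Löschian (+ (t′ ℕ.* m))
    strip (k , tm≡pk , Lk) = t′ , t≡pt′ , subst (Löschian ∘ +_) k≡t′m Lk
      where
      p∣t : p ℕ.∣ t
      p∣t with euclidsLemma t m pr (ℕ.divides k (trans tm≡pk (ℕ.*-comm p k)))
      ... | inj₁ p∣t = p∣t
      ... | inj₂ p∣m = contradiction p∣m p∤m
      t′ = ℕ.quotient p∣t
      t≡pt′ : t ≡ p ℕ.* t′
      t≡pt′ = ℕ.m∣n⇒n≡m*quotient p∣t
      k≡t′m : k ≡ t′ ℕ.* m
      k≡t′m = ℕ.*-cancelˡ-≡ k (t′ ℕ.* m) p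
        (trans (sym tm≡pk) (trans (cong (ℕ._* m) t≡pt′) (ℕ.*-assoc p t′ m)))

  Coprime₂ : ℕ → ℕ → Set
  Coprime₂ s m = ∀ {q} → Prime q → q % 3 ≡ 2 → q ℕ.∣ s → ¬ q ℕ.∣ m

  Coprime₂-∣ : ∀ {s t m} → t ℕ.∣ s → Coprime₂ s m → Coprime₂ t m
  Coprime₂-∣ t∣s coprime qr q%3≡2 q∣t = coprime qr q%3≡2 (ℕ.∣-trans q∣t t∣s)

  LöschianMultiple : ℕ → Set
  LöschianMultiple s = ∃ λ m → s % 3 ≡ 2 × Coprime₂ s m × Löschian (+ (s ℕ.* m))

  löschianMultiple-p≡1 : ∀ {p s} → Prime p → p % 3 ≡ 1 → LöschianMultiple (p ℕ.* s) → LöschianMultiple s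
  löschianMultiple-p≡1 {p} {s} pr p%3≡1 (m , ps%3≡2 , coprime , L) =
    p ℕ.* m , s%3≡2 , coprime′ , subst (Löschian ∘ +_) ps*m≡s*pm L
    where
    ps*m≡s*pm : p ℕ.* s ℕ.* m ≡ s ℕ.* (p ℕ.* m)
    ps*m≡s*pm = trans (cong (ℕ._* m) (ℕ.*-comm p s)) (ℕ.*-assoc s p m)
    s%3≡2 : s % 3 ≡ 2
    s%3≡2 with m*n%3≡2⇒ p s ps%3≡2
    ... | inj₁ (_ , s%3≡2) = s%3≡2
    ... | inj₂ (p%3≡2 , _) = contradiction (trans (sym p%3≡1) p%3≡2) λ ()
    coprime′ : Coprime₂ s (p ℕ.* m)
    coprime′ qr q%3≡2 q∣s q∣pm with euclidsLemma p m qr q∣pm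
    ... | inj₁ q∣p =
      contradiction (trans (sym p%3≡1) (subst (λ n → n % 3 ≡ 2) (prime∣prime⇒≡ qr pr q∣p) q%3≡2)) λ ()
    ... | inj₂ q∣m = Coprime₂-∣ (ℕ.n∣m*n p) coprime qr q%3≡2 q∣s q∣m

  löschianMultiple-p≡2 : ∀ {p s} → Prime p → p % 3 ≡ 2 → LöschianMultiple (p ℕ.* s) →
                         ∃ λ s′ → s ≡ p ℕ.* s′ × LöschianMultiple s′
  löschianMultiple-p≡2 {p} {s} pr p%3≡2 (m , ps%3≡2 , coprime , L) =
    descend (löschian-strip pr p%3≡2 (coprime pr p%3≡2 (ℕ.m∣m*n s))
                            (subst (Löschian ∘ +_) (ℕ.*-assoc p s m) L))
    where
    descend : (∃ λ s′ → s ≡ p ℕ.* s′ × Löschian (+ (s′ ℕ.* m))) →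
              ∃ λ s′ → s ≡ p ℕ.* s′ × LöschianMultiple s′
    descend (s′ , s≡ps′ , L′) = s′ , s≡ps′ , m , s′%3≡2 , Coprime₂-∣ s′∣ps coprime , L′
      where
      ps≡p²s′ : p ℕ.* s ≡ p ℕ.* p ℕ.* s′
      ps≡p²s′ = trans (cong (p ℕ.*_) s≡ps′) (sym (ℕ.*-assoc p p s′))
      s′∣ps : s′ ℕ.∣ p ℕ.* s
      s′∣ps = subst (s′ ℕ.∣_) (sym ps≡p²s′) (ℕ.n∣m*n (p ℕ.* p))
      s′%3≡2 : s′ % 3 ≡ 2
      s′%3≡2 with m*n%3≡2⇒ (p ℕ.* p) s′ (subst (λ n → n % 3 ≡ 2) ps≡p²s′ ps%3≡2)
      ... | inj₁ (_ , s′%3≡2) = s′%3≡2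
      ... | inj₂ (p²%3≡2 , _) = contradiction (trans (sym (n%3≡2⇒n*n%3≡1 {p} p%3≡2)) p²%3≡2) λ ()

  löschianMultiple-shrinks : ∀ {s} → LöschianMultiple s → ∃ λ s′ → s′ < s × LöschianMultiple s′
  löschianMultiple-shrinks {s} W@(_ , s%3≡2 , _) = shrink (∃-prime-divisor (n%3≡2⇒2≤n {s} s%3≡2))
    where
    shrink : (∃ λ p → Prime p × p ℕ.∣ s) → ∃ λ s′ → s′ < s × LöschianMultiple s′
    shrink (p , pr , p∣s) =
      [ via-p≡1 ∘ proj₁ , via-p≡2 ∘ proj₁ ] (m*n%3≡2⇒ p s₁ (subst (λ n → n % 3 ≡ 2) s≡ps₁ s%3≡2))
      where
      instance
        _ = prime⇒nonTrivial pr
        _ = prime⇒nonZero pr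
        _ = ℕ.>-nonZero (ℕ.<-≤-trans z<s (n%3≡2⇒2≤n {s} s%3≡2))
      s₁ = ℕ.quotient p∣s
      s≡ps₁ : s ≡ p ℕ.* s₁
      s≡ps₁ = ℕ.m∣n⇒n≡m*quotient p∣s
      W′ : LöschianMultiple (p ℕ.* s₁)
      W′ = subst LöschianMultiple s≡ps₁ W

      via-p≡1 : p % 3 ≡ 1 → ∃ λ s′ → s′ < s × LöschianMultiple s′
      via-p≡1 p%3≡1 = s₁ , ℕ.quotient-< p∣s , löschianMultiple-p≡1 pr p%3≡1 W′

      via-p≡2 : p % 3 ≡ 2 → ∃ λ s′ → s′ < s × LöschianMultiple s′
      via-p≡2 p%3≡2 = let s₂ , s₁≡ps₂ , W″ = löschianMultiple-p≡2 pr p%3≡2 W′ in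
        s₂ , ℕ.≤-<-trans (subst (s₂ ≤_) (sym s₁≡ps₂) (ℕ.m≤n*m s₂ p)) (ℕ.quotient-< p∣s) , W″

  ¬löschianMultiple : ∀ s → ¬ LöschianMultiple s
  ¬löschianMultiple = <-rec (λ s → ¬ LöschianMultiple s) λ s rec W →
    let s′ , s′<s , W′ = löschianMultiple-shrinks W in rec s′<s W′

open LöschianNumbers using (Löschian; norm; n%3≡2⇒n∤3; Coprime₂; ¬löschianMultiple)

module Autocorrelation where

  open import Defs
  open import Data.Integer as ℤ using (ℤ; +_; -_; _+_; _*_; _-_; 0ℤ; 1ℤ)
  import Data.Integer.Properties as ℤ
  open import Data.Integer.Tactic.RingSolver using (solve-∀)
  open import Algebra.Bundles using (AbelianGroup)
  open import Algebra.Properties.Group (AbelianGroup.group ℤ.+-0-abelianGroup)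
    using () renaming (∙-cancelˡ to +-cancelˡ)

  sumTo-cong : ∀ m {f g : ℕ → ℤ} → (∀ i → i < m → f i ≡ g i) → sumTo m f ≡ sumTo m g
  sumTo-cong zero    f≡g = refl
  sumTo-cong (suc m) f≡g =
    cong₂ _+_ (sumTo-cong m (λ i i<m → f≡g i (ℕ.m<n⇒m<1+n i<m))) (f≡g m (ℕ.n<1+n m))

  sumTo-const : ∀ m c → sumTo m (λ _ → c) ≡ + m * c
  sumTo-const zero    c = sym (ℤ.*-zeroˡ c)
  sumTo-const (suc m) c =
    trans (cong (_+ c) (sumTo-const m c)) (trans (ℤ.+-comm (+ m * c) c) (sym (ℤ.suc-* (+ m) c)))

  sumTo-+ : ∀ m (f g : ℕ → ℤ) → sumTo m (λ i → f i + g i) ≡ sumTo m f + sumTo m g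
  sumTo-+ zero    f g = refl
  sumTo-+ (suc m) f g =
    trans (cong (_+ (f m + g m)) (sumTo-+ m f g)) (interchange (sumTo m f) (sumTo m g) (f m) (g m))
    where
    interchange : ∀ a b c d → a + b + (c + d) ≡ a + c + (b + d)
    interchange = solve-∀

  sumTo-*ˡ : ∀ m c (f : ℕ → ℤ) → sumTo m (λ i → c * f i) ≡ c * sumTo m f
  sumTo-*ˡ zero    c f = sym (ℤ.*-zeroʳ c)
  sumTo-*ˡ (suc m) c f =
    trans (cong (_+ c * f m) (sumTo-*ˡ m c f)) (sym (ℤ.*-distribˡ-+ c (sumTo m f) (f m)))

  sumTo-*ʳ : ∀ m c (f : ℕ → ℤ) → sumTo m (λ i → f i * c) ≡ sumTo m f * c
  sumTo-*ʳ m c f =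
    trans (sumTo-cong m (λ i _ → ℤ.*-comm (f i) c)) (trans (sumTo-*ˡ m c f) (ℤ.*-comm c (sumTo m f)))

  sumTo-comm : ∀ m k (F : ℕ → ℕ → ℤ) →
               sumTo m (λ u → sumTo k (F u)) ≡ sumTo k (λ i → sumTo m (λ u → F u i))
  sumTo-comm zero    k F = sym (trans (sumTo-const k 0ℤ) (ℤ.*-zeroʳ (+ k)))
  sumTo-comm (suc m) k F = trans (cong (_+ sumTo k (F m)) (sumTo-comm m k F))
    (sym (sumTo-+ k (λ i → sumTo m (λ u → F u i)) (F m)))

  sumTo-suc : ∀ m (f : ℕ → ℤ) → sumTo (suc m) f ≡ f 0 + sumTo m (f ∘ suc)
  sumTo-suc zero    f = ℤ.+-comm 0ℤ (f 0)
  sumTo-suc (suc m) f = trans (cong (_+ f (suc m)) (sumTo-suc m f)) (ℤ.+-assoc (f 0) _ _)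

  sumTo-rotate : ∀ m (f : ℕ → ℤ) → f m ≡ f 0 → sumTo m (f ∘ suc) ≡ sumTo m f
  sumTo-rotate m f fm≡f0 = +-cancelˡ (f 0) _ _ (begin
    f 0 + sumTo m (f ∘ suc)  ≡⟨ sumTo-suc m f ⟨
    sumTo m f + f m          ≡⟨ cong (λ x → sumTo m f + x) fm≡f0 ⟩
    sumTo m f + f 0          ≡⟨ ℤ.+-comm (sumTo m f) (f 0) ⟩
    f 0 + sumTo m f          ∎)
    where open ≡-Reasoning

  sumTo-residues : ∀ q (f : ℕ → ℤ) → sumTo (q ℕ.* 3) f
    ≡ sumTo q (λ r → f (r ℕ.* 3)) + sumTo q (λ r → f (1 ℕ.+ r ℕ.* 3)) + sumTo q (λ r → f (2 ℕ.+ r ℕ.* 3))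
  sumTo-residues zero    f = refl
  sumTo-residues (suc q) f =
    trans (cong (λ S → S + f (q ℕ.* 3) + f (1 ℕ.+ q ℕ.* 3) + f (2 ℕ.+ q ℕ.* 3)) (sumTo-residues q f))
          (interleave (sumTo q (λ r → f (r ℕ.* 3))) (sumTo q (λ r → f (1 ℕ.+ r ℕ.* 3)))
                      (sumTo q (λ r → f (2 ℕ.+ r ℕ.* 3)))
                      (f (q ℕ.* 3)) (f (1 ℕ.+ q ℕ.* 3)) (f (2 ℕ.+ q ℕ.* 3)))
    where
    interleave : ∀ a b c x y z → a + b + c + x + y + z ≡ a + x + (b + y) + (c + z)
    interleave = solve-∀

  module Decimation (q : ℕ) (a : ℕ → ℤ) (periodic : ∀ j → a (j ℕ.+ q ℕ.* 3) ≡ a j) where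

    c : ℕ → ℤ
    c k = sumTo q (λ r → a (k ℕ.+ r ℕ.* 3))

    c-3+ : ∀ k → c (3 ℕ.+ k) ≡ c k
    c-3+ k = trans (sumTo-cong q (λ r _ → cong a (shift k r)))
      (sumTo-rotate q (λ r → a (k ℕ.+ r ℕ.* 3)) (trans (periodic k) (cong a (sym (ℕ.+-identityʳ k)))))
      where
      shift : ∀ k r → 3 ℕ.+ k ℕ.+ r ℕ.* 3 ≡ k ℕ.+ suc r ℕ.* 3
      shift = ℕ.solve-∀

    c-periodic : ∀ r k → c (r ℕ.* 3 ℕ.+ k) ≡ c k
    c-periodic zero    k = refl
    c-periodic (suc r) k = trans (c-3+ (r ℕ.* 3 ℕ.+ k)) (c-periodic r k)

    sumTo-residue-class : ∀ k t →
      sumTo q (λ r → a (k ℕ.+ r ℕ.* 3) * c (k ℕ.+ r ℕ.* 3 ℕ.+ t)) ≡ c k * c (k ℕ.+ t)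
    sumTo-residue-class k t =
      trans (sumTo-cong q λ r _ → cong (a (k ℕ.+ r ℕ.* 3) *_)
                                       (trans (cong c (regroup k r t)) (c-periodic r (k ℕ.+ t))))
            (sumTo-*ʳ q (c (k ℕ.+ t)) (λ r → a (k ℕ.+ r ℕ.* 3)))
      where
      regroup : ∀ k r t → k ℕ.+ r ℕ.* 3 ℕ.+ t ≡ r ℕ.* 3 ℕ.+ (k ℕ.+ t)
      regroup = ℕ.solve-∀

    sumTo-decimated-autocorr : ∀ t → sumTo q (λ u → autocorr (q ℕ.* 3) a (u ℕ.* 3 ℕ.+ t))
                                    ≡ c 0 * c t + c 1 * c (1 ℕ.+ t) + c 2 * c (2 ℕ.+ t)
    sumTo-decimated-autocorr t = begin
      sumTo q (λ u → sumTo n (λ i → a i * a (i ℕ.+ (u ℕ.* 3 ℕ.+ t))))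
        ≡⟨ sumTo-comm q n (λ u i → a i * a (i ℕ.+ (u ℕ.* 3 ℕ.+ t))) ⟩
      sumTo n (λ i → sumTo q (λ u → a i * a (i ℕ.+ (u ℕ.* 3 ℕ.+ t))))
        ≡⟨ sumTo-cong n (λ i _ → pull-out i) ⟩
      sumTo n (λ i → a i * c (i ℕ.+ t))
        ≡⟨ sumTo-residues q (λ i → a i * c (i ℕ.+ t)) ⟩
      sumTo q (λ r → a (r ℕ.* 3) * c (r ℕ.* 3 ℕ.+ t))
        + sumTo q (λ r → a (1 ℕ.+ r ℕ.* 3) * c (1 ℕ.+ r ℕ.* 3 ℕ.+ t))
        + sumTo q (λ r → a (2 ℕ.+ r ℕ.* 3) * c (2 ℕ.+ r ℕ.* 3 ℕ.+ t))
        ≡⟨ cong₂ _+_ (cong₂ _+_ (sumTo-residue-class 0 t) (sumTo-residue-class 1 t))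
                     (sumTo-residue-class 2 t) ⟩
      c 0 * c t + c 1 * c (1 ℕ.+ t) + c 2 * c (2 ℕ.+ t)
        ∎
      where
      open ≡-Reasoning
      n = q ℕ.* 3
      regroup : ∀ i u t → i ℕ.+ (u ℕ.* 3 ℕ.+ t) ≡ i ℕ.+ t ℕ.+ u ℕ.* 3
      regroup = ℕ.solve-∀
      pull-out : ∀ i → sumTo q (λ u → a i * a (i ℕ.+ (u ℕ.* 3 ℕ.+ t))) ≡ a i * c (i ℕ.+ t)
      pull-out i = trans (sumTo-*ˡ q (a i) (λ u → a (i ℕ.+ (u ℕ.* 3 ℕ.+ t))))
                         (cong (a i *_) (sumTo-cong q (λ u _ → cong a (regroup i u t))))

  ±1-square : ∀ {x} → x ≡ 1ℤ ⊎ x ≡ - 1ℤ → x * x ≡ 1ℤ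
  ±1-square (inj₁ refl) = refl
  ±1-square (inj₂ refl) = refl

  two-level⇒löschian : ∀ q′ (a : ℕ → ℤ) γ → let n = suc q′ ℕ.* 3 in
    IsBinarySeq n a → (∀ t → 1 ≤ t → t ≤ n ∸ 1 → autocorr n a t ≡ γ) → Löschian (+ n - γ)
  two-level⇒löschian q′ a γ (±1 , periodic) offpeak = c 0 - c 1 , c 1 - c 2 , (begin
    norm (c 0 - c 1) (c 1 - c 2)
      ≡⟨ norm-of-differences (c 0) (c 1) (c 2) ⟩
    (c 0 * c 0 + c 1 * c 1 + c 2 * c 2) - (c 0 * c 1 + c 1 * c 2 + c 2 * c 0)
      ≡⟨ cong₂ _-_ squares products ⟩
    (+ n + + q′ * γ) - (γ + + q′ * γ)
      ≡⟨ cancel (+ n) (+ q′) γ ⟩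
    + n - γ
      ∎)
    where
    open ≡-Reasoning
    n = suc q′ ℕ.* 3
    open Decimation (suc q′) a periodic

    C = autocorr n a

    peak : C 0 ≡ + n
    peak = trans (sumTo-cong n λ i _ → trans (cong (λ j → a i * a j) (ℕ.+-identityʳ i)) (±1-square (±1 i)))
                 (trans (sumTo-const n 1ℤ) (ℤ.*-identityʳ (+ n)))

    squares : c 0 * c 0 + c 1 * c 1 + c 2 * c 2 ≡ + n + + q′ * γ
    squares = begin
      c 0 * c 0 + c 1 * c 1 + c 2 * c 2             ≡⟨ sumTo-decimated-autocorr 0 ⟨
      sumTo (suc q′) (λ u → C (u ℕ.* 3 ℕ.+ 0))      ≡⟨ sumTo-suc q′ (λ u → C (u ℕ.* 3 ℕ.+ 0)) ⟩
      C 0 + sumTo q′ (λ u → C (suc u ℕ.* 3 ℕ.+ 0))  ≡⟨ cong₂ _+_ peak (sumTo-cong q′ λ u u<q′ →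
                                                          offpeak _ (s≤s z≤n) (in-range u<q′)) ⟩
      + n + sumTo q′ (λ _ → γ)                      ≡⟨ cong (λ x → + n + x) (sumTo-const q′ γ) ⟩
      + n + + q′ * γ                                ∎
      where
      in-range : ∀ {u} → u < q′ → suc u ℕ.* 3 ℕ.+ 0 ≤ n ∸ 1
      in-range u<q′ =
        ℕ.≤-trans (ℕ.≤-reflexive (ℕ.+-identityʳ _)) (ℕ.≤-trans (ℕ.*-monoˡ-≤ 3 u<q′) (ℕ.m≤n+m _ 2))

    products : c 0 * c 1 + c 1 * c 2 + c 2 * c 0 ≡ γ + + q′ * γ
    products = begin
      c 0 * c 1 + c 1 * c 2 + c 2 * c 0             ≡⟨ cong (λ x → c 0 * c 1 + c 1 * c 2 + c 2 * x) (c-3+ 0) ⟨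
      c 0 * c 1 + c 1 * c 2 + c 2 * c 3             ≡⟨ sumTo-decimated-autocorr 1 ⟨
      sumTo (suc q′) (λ u → C (u ℕ.* 3 ℕ.+ 1))      ≡⟨ sumTo-cong (suc q′) (λ u u≤q′ →
                                                          offpeak _ (ℕ.m≤n+m 1 _) (in-range u≤q′)) ⟩
      sumTo (suc q′) (λ _ → γ)                      ≡⟨ sumTo-const (suc q′) γ ⟩
      + suc q′ * γ                                  ≡⟨ ℤ.suc-* (+ q′) γ ⟩
      γ + + q′ * γ                                  ∎
      where
      in-range : ∀ {u} → u < suc q′ → u ℕ.* 3 ℕ.+ 1 ≤ n ∸ 1
      in-range (s≤s u≤q′) =
        ℕ.≤-trans (ℕ.≤-reflexive (ℕ.+-comm _ 1)) (s≤s (ℕ.≤-trans (ℕ.*-monoˡ-≤ 3 u≤q′) (ℕ.n≤1+n _)))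

    norm-of-differences : ∀ c₀ c₁ c₂ →
      (c₀ - c₁) * (c₀ - c₁) + (c₀ - c₁) * (c₁ - c₂) + (c₁ - c₂) * (c₁ - c₂)
        ≡ (c₀ * c₀ + c₁ * c₁ + c₂ * c₂) - (c₀ * c₁ + c₁ * c₂ + c₂ * c₀)
    norm-of-differences = solve-∀

    cancel : ∀ n q γ → (n + q * γ) - (γ + q * γ) ≡ n - γ
    cancel = solve-∀

open Autocorrelation using (two-level⇒löschian)

open import Defs
open import Data.Nat using (ℕ; _+_; _*_; _%_; _≤_; _∸_; suc)
open import Data.Integer using (ℤ; +_)
open import Data.Product using (_×_; ∃)
open import Data.Sum using (_⊎_)
open import Relation.Binary.PropositionalEquality using (_≡_)
open import Relation.Nullary using (¬_)
open import Data.Integer using (_-_)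
import Data.Integer.Properties as ℤ

∣-adjacent⇒∣1 : ∀ {d x y} → suc y ≡ x ⊎ y ≡ suc x → d ℕ.∣ x → d ℕ.∣ y → d ℕ.∣ 1
∣-adjacent⇒∣1 {d} {y = y} (inj₁ refl) d∣1+y d∣y = ℕ.∣m+n∣m⇒∣n (subst (d ℕ.∣_) (ℕ.+-comm 1 y) d∣1+y) d∣y
∣-adjacent⇒∣1 {d} {x = x} (inj₂ refl) d∣x d∣1+x = ℕ.∣m+n∣m⇒∣n (subst (d ℕ.∣_) (ℕ.+-comm 1 x) d∣1+x) d∣x

¬löschian-adjacent : ∀ s s′ → s % 3 ≡ 2 → suc s′ ≡ s ⊎ s′ ≡ suc s → ¬ Löschian (+ (s * (9 * s′)))
¬löschian-adjacent s s′ s%3≡2 adjacent L = ¬löschianMultiple s (9 * s′ , s%3≡2 , coprime , L)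
  where
  coprime : Coprime₂ s (9 * s′)
  coprime qr q%3≡2 q∣s q∣9s′ with euclidsLemma 9 s′ qr q∣9s′
  ... | inj₁ q∣9  = [ n%3≡2⇒n∤3 q%3≡2 , n%3≡2⇒n∤3 q%3≡2 ] (euclidsLemma 3 3 qr q∣9)
  ... | inj₂ q∣s′ = ¬prime[1] (subst Prime (ℕ.∣1⇒≡1 (∣-adjacent⇒∣1 adjacent q∣s q∣s′)) qr)

A%72⇒A%18 : ∀ A → A % 72 ≡ 27 ⊎ A % 72 ≡ 45 ⊎ A % 72 ≡ 51 ⊎ A % 72 ≡ 69 → A % 18 ≡ 9 ⊎ A % 18 ≡ 15
A%72⇒A%18 A = reduce
  where
  via : ∀ {r} → A % 72 ≡ r → A % 18 ≡ r % 18
  via A%72≡r = trans (sym (m∣n⇒o%n%m≡o%m 18 72 A (ℕ.divides 4 refl))) (cong (_% 18) A%72≡r)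
  reduce : A % 72 ≡ 27 ⊎ A % 72 ≡ 45 ⊎ A % 72 ≡ 51 ⊎ A % 72 ≡ 69 → A % 18 ≡ 9 ⊎ A % 18 ≡ 15
  reduce (inj₁ r)               = inj₁ (via r)
  reduce (inj₂ (inj₁ r))        = inj₁ (via r)
  reduce (inj₂ (inj₂ (inj₁ r))) = inj₂ (via r)
  reduce (inj₂ (inj₂ (inj₂ r))) = inj₂ (via r)

-- A = 18j + 9 gives n − 3 = (3j + 2) · 9(3j + 1), and A = 18j + 15 gives n − 3 = (3j + 2) · 9(3j + 3).
period-shape : ∀ A n → A % 18 ≡ 9 ⊎ A % 18 ≡ 15 → 4 * n ≡ A * A + 3 →
  ∃₂ λ s s′ → s % 3 ≡ 2 × (suc s′ ≡ s ⊎ s′ ≡ suc s) × n ≡ suc (s * (3 * s′)) * 3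
period-shape A n (inj₁ A%18≡9) 4n≡A²+3 =
  2 + j * 3 , 1 + j * 3 , [m+kn]%n≡m%n 2 j 3 , inj₁ refl ,
  ℕ.*-cancelˡ-≡ n _ 4 (trans 4n≡A²+3 (trans (cong (λ A → A * A + 3) A≡9+18j) (expand j)))
  where
  j = A / 18
  A≡9+18j : A ≡ 9 + j * 18
  A≡9+18j = trans (m≡m%n+[m/n]*n A 18) (cong (_+ j * 18) A%18≡9)
  expand : ∀ j → (9 + j * 18) * (9 + j * 18) + 3 ≡ 4 * (suc ((2 + j * 3) * (3 * (1 + j * 3))) * 3)
  expand = ℕ.solve-∀
period-shape A n (inj₂ A%18≡15) 4n≡A²+3 =
  2 + j * 3 , 3 + j * 3 , [m+kn]%n≡m%n 2 j 3 , inj₂ refl ,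
  ℕ.*-cancelˡ-≡ n _ 4 (trans 4n≡A²+3 (trans (cong (λ A → A * A + 3) A≡15+18j) (expand j)))
  where
  j = A / 18
  A≡15+18j : A ≡ 15 + j * 18
  A≡15+18j = trans (m≡m%n+[m/n]*n A 18) (cong (_+ j * 18) A%18≡15)
  expand : ∀ j → (15 + j * 18) * (15 + j * 18) + 3 ≡ 4 * (suc ((2 + j * 3) * (3 * (3 + j * 3))) * 3)
  expand = ℕ.solve-∀

lemma4p3 : (A n : ℕ) → 1 ≤ A →
    (A % 72 ≡ 27) ⊎ (A % 72 ≡ 45) ⊎ (A % 72 ≡ 51) ⊎ (A % 72 ≡ 69) →
    4 * n ≡ A * A + 3 →
    ¬ (∃ λ (a : ℕ → ℤ) → IsBinarySeq n a ×
         ((t : ℕ) → 1 ≤ t → t ≤ n ∸ 1 → autocorr n a t ≡ + 3))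
lemma4p3 A n _ A%72 4n≡A²+3 (a , binary , offpeak)
  with s , s′ , s%3≡2 , adjacent , refl ← period-shape A n (A%72⇒A%18 A A%72) 4n≡A²+3 =
  ¬löschian-adjacent s s′ s%3≡2 adjacent
    (subst Löschian n-3≡s*9s′ (two-level⇒löschian (s * (3 * s′)) a (+ 3) binary offpeak))
  where
  n-3≡s*9s′ : + (suc (s * (3 * s′)) * 3) - + 3 ≡ + (s * (9 * s′))
  n-3≡s*9s′ = trans (ℤ.m-n≡m⊖n (3 + s * (3 * s′) * 3) 3)
    (trans (ℤ.+-cancelˡ-⊖ 3 (s * (3 * s′) * 3) 0) (cong +_ (regroup s s′)))
    where
    regroup : ∀ s s′ → s * (3 * s′) * 3 ≡ s * (9 * s′)
    regroup = ℕ.solve-∀
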